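{- For any $s,t,k\in\mathbb{N}$ there exists a constant $\ell$ such that the following holds. Let $G$ be a bipartite graph with $\mathrm{ch}(G)<k$ that does not contain $S_{s,t}$ as an induced subgraph. Let $\mathcal{Y}$ be any Gyárfás decomposition of $G$. Then $\mathcal{Y}$ has maximum back-degree at most $\ell$.
   Context: $S_{s,t}$ is the subdivided star: the star with $s$ leaves in which each edge is subdivided $t-1$ times. Chain-index $\mathrm{ch}(G)$: the largest $k$ such that there are $2k$ distinct vertices $a_1,\dots,a_k,b_1,\dots,b_k$ with, for all $i<j$, $a_ib_j$ an edge and $b_ia_j$ a non-edge. Gyárfás decomposition of a connected bipartite graph $G$: a rooted tree $\mathcal{Y}$ such that (1) each node of $\mathcal{Y}$ is a subset of $V(G)$ (a bag) and the bags partition $V(G)$; write $\mathrm{bag}(v)$ for the bag containing $v$; (2) the root bag is a singleton (the root vertex); (3) if $u,v$ are adjacent then $\mathrm{bag}(u)$ is an ancestor of $\mathrm{bag}(v)$ or vice versa (a bag counts as its own ancestor); (4) for every bag $B$, the subgraph of $G$ induced by $B$ together with all its descendant bags is connected; (5) for every non-root bag $B$ there is a vertex $h(B)$ (the hook of $B$) in the parent bag of $B$ that is adjacent to all vertices of $B$ and to no vertex of the strict descendant bags of $B$. A Gyárfás decomposition of a disconnected bipartite graph is the union of Gyárfás decompositions of its connected components. A bag $B$ has an edge to a bag $B'$ if some vertex of $B$ is adjacent to some vertex of $B'$. The back-degree of $B$ is the number of (strict) ancestor bags of $B$ to which $B$ has an edge; the maximum back-degree of $\mathcal{Y}$ is the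 maximum back-degree over its bags. -}

module Defs where

open import Data.Nat using (ℕ; zero; suc; _<_; _≤_)
open import Data.Fin using (Fin; toℕ)
open import Data.Bool using (Bool; true; false; T)
open import Data.Maybe using (Maybe; just; nothing)
open import Data.Product using (Σ; ∃; _×_; _,_)
open import Data.Sum using (_⊎_)
open import Data.List using (List; length)
open import Data.List.Membership.Propositional using (_∈_)
open import Relation.Binary.PropositionalEquality using (_≡_; _≢_)
open import Relation.Nullary using (¬_)
open import Data.Empty using (⊥)

record Graph : Set where
  field
    n      : ℕ
    adj    : Fin n → Fin n → Bool
    sym    : ∀ u v → adj u v ≡ adj v u
    irrefl : ∀ v → adj v v ≡ false

  E : Fin n → Fin n → Set
  E u v = T (adj u v)

open Graph public

Bipartite : Graph → Set
Bipartite G = Σ (Fin (n G) → Bool) λ col → ∀ u v → E G u v → col u ≢ col v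

HasChain : (G : Graph) → ℕ → Set
HasChain G k =
  Σ (Fin k → Fin (n G)) λ a → Σ (Fin k → Fin (n G)) λ b →
    (∀ i j → a i ≡ a j → i ≡ j) ×
    (∀ i j → b i ≡ b j → i ≡ j) ×
    (∀ i j → a i ≢ b j) ×
    (∀ (i j : Fin k) → toℕ i < toℕ j → E G (a i) (b j) × ¬ E G (b i) (a j))

-- ch(G) < k  (ch(G) is the largest size of a chain; the chain property is
-- downward closed, so ch(G) < k iff there is no chain of size k)
ChainIndexBelow : Graph → ℕ → Set
ChainIndexBelow G k = ¬ HasChain G k

-- Subdivided star S_{s,t}: centre `nothing`, and `just (i , j)` is the
-- vertex at distance (toℕ j + 1) from the centre on the i-th leg.

SVert : ℕ → ℕ → Set
SVert s t = Maybe (Fin s × Fin t)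

SAdj : ∀ {s t} → SVert s t → SVert s t → Set
SAdj nothing nothing = ⊥
SAdj nothing (just (i , j)) = toℕ j ≡ 0
SAdj (just (i , j)) nothing = toℕ j ≡ 0
SAdj (just (i , j)) (just (i' , j')) =
  i ≡ i' × (toℕ j' ≡ suc (toℕ j) ⊎ toℕ j ≡ suc (toℕ j'))

ContainsInducedS : ℕ → ℕ → Graph → Set
ContainsInducedS s t G =
  Σ (SVert s t → Fin (n G)) λ f →
    (∀ x y → f x ≡ f y → x ≡ y) ×
    (∀ x y → SAdj x y → E G (f x) (f y)) ×
    (∀ x y → E G (f x) (f y) → SAdj x y)

data PathIn (G : Graph) (S : Fin (n G) → Set) : Fin (n G) → Fin (n G) → Set where
  here : ∀ {u} → S u → PathIn G S u u
  step : ∀ {u w v} → S u → E G u w → PathIn G S w v → PathIn G S u v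

ConnectedIn : (G : Graph) → (Fin (n G) → Set) → Set
ConnectedIn G S = ∀ u v → S u → S v → PathIn G S u v

data Anc {m : ℕ} (par : Fin m → Maybe (Fin m)) : Fin m → Fin m → Set where
  anc-refl : ∀ {b} → Anc par b b
  anc-step : ∀ {a b c} → par b ≡ just c → Anc par a c → Anc par a b

-- Gyárfás decomposition of G (a forest: one rooted tree per component).
-- Bags are indexed by Fin m; `bag v` is the bag containing v; `par B` is
-- the parent bag of B (nothing for a root).
record Gyarfas (G : Graph) : Set where
  field
    m        : ℕ
    par      : Fin m → Maybe (Fin m)
    bag      : Fin (n G) → Fin m
    -- acyclicity of the parent relation
    depth    : Fin m → ℕ
    depth-par : ∀ B C → par B ≡ just C → depth C < depth B
    nonempty : ∀ B → ∃ λ v → bag v ≡ B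
    root-singleton : ∀ B → par B ≡ nothing →
                     ∃ λ r → bag r ≡ B × (∀ v → bag v ≡ B → v ≡ r)
    comparable : ∀ u v → E G u v → Anc par (bag u) (bag v) ⊎ Anc par (bag v) (bag u)
    connected : ∀ B → ConnectedIn G (λ v → Anc par B (bag v))
    hook : ∀ B P → par B ≡ just P →
           ∃ λ h → bag h ≡ P ×
             (∀ v → bag v ≡ B → E G h v) ×
             (∀ v → Anc par B (bag v) → bag v ≢ B → ¬ E G h v)

  StrictAnc : Fin m → Fin m → Set
  StrictAnc A B = Anc par A B × A ≢ B

  BagEdge : Fin m → Fin m → Set
  BagEdge B B' = ∃ λ u → ∃ λ v → bag u ≡ B × bag v ≡ B' × E G u v

  BackDegreeAtMost : Fin m → ℕ → Set
  BackDegreeAtMost B ℓ =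
    Σ (List (Fin m)) λ L → length L ≤ ℓ ×
      (∀ A → StrictAnc A B → BagEdge B A → A ∈ L)

  MaxBackDegreeAtMost : ℕ → Set
  MaxBackDegreeAtMost ℓ = ∀ B → BackDegreeAtMost B ℓ

open Gyarfas public

-- Fix a bag B. A strict ancestor bag at level r joined to B by an edge u–v gives an induced path
-- going up the tree: u ∈ B, v at level r, then the hooks above levels r, r + 1, …, each adjacent to
-- its predecessor and to nothing lower.  By Ramsey's theorem, among many such levels many are pairwise
-- more than t apart; legs that far apart can only meet through a hook above an earlier leg seeing the
-- high end v of a later one, and a large homogeneous set of such incidences is a chain of length k
-- (hooks as the a's, high ends as the b's).  Having removed them, two more Ramsey steps deal with
-- edges from the low end of one leg to the high end of another: a large clique of them is a spider
-- centred at one low end, and otherwise the hook above B, adjacent to every low end, is the centre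
-- of a spider on the high ends or on the low ends.  Bipartiteness keeps low ends pairwise
-- non-adjacent, and likewise high ends.
module Submission where

open import Defs hiding (sym)

open import Data.Nat using (ℕ; zero; suc; _+_; _≤_; _<_; z≤n; s≤s; _≤?_)
open import Data.Nat.Properties
open import Data.Nat.GeneralisedArithmetic using (iterate)
open import Data.Fin as Fin using (Fin; toℕ; inject≤)
import Data.Fin.Properties as Fin
open import Data.List using (List; []; _∷_; length; filter; lookup; map)
open import Data.List.Relation.Unary.Any using (here; there)
open import Data.List.Relation.Unary.All as All using (All; []; _∷_)
open import Data.List.Relation.Unary.All.Properties using (all-filter)
open import Data.List.Relation.Unary.AllPairs as AllPairs using (AllPairs; []; _∷_)
open import Data.List.Membership.Propositional using (_∈_)
open import Data.List.Membership.Propositional.Properties using (∈-lookup)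
open import Data.List.Relation.Binary.Sublist.Propositional
  using (_⊆_; []; _∷_; _∷ʳ_; ⊆-refl; ⊆-trans; minimum)
open import Data.List.Relation.Binary.Sublist.Propositional.Properties using (All-resp-⊆)
open import Data.List.Relation.Binary.Sublist.Propositional.Properties using (filter-⊆)
open import Data.List.Properties using (filter-all; length-map)
open import Data.Empty using (⊥; ⊥-elim)
open import Data.Bool using (Bool; not; T)
open import Data.Bool.Properties using (¬-not; not-involutive)
open import Data.Maybe using (Maybe; just; nothing)
import Data.Maybe.Properties as Maybe
open import Data.Unit using (⊤; tt)
open import Relation.Nullary.Decidable using (_×-dec_; T?)
open import Function using (_∘_)
open import Relation.Binary using (tri<; tri≈; tri>)
open import Data.Product using (∃; _×_; _,_; proj₁; proj₂)
open import Data.Sum using (_⊎_; inj₁; inj₂)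
open import Relation.Nullary using (¬_; Dec; yes; no)
open import Relation.Unary using (Decidable)
open import Relation.Unary.Properties using (∁?)
open import Relation.Binary.PropositionalEquality using (_≡_; _≢_; refl; cong; sym; trans; subst; subst₂; ≢-sym)

m+n≤o+p⇒m≤o⊎n≤p : ∀ m n o p → m + n ≤ o + p → m ≤ o ⊎ n ≤ p
m+n≤o+p⇒m≤o⊎n≤p m n o p le with m ≤? o
... | yes m≤o = inj₁ m≤o
... | no m≰o = inj₂ (+-cancelˡ-≤ o n p (≤-trans (+-monoˡ-≤ n (<⇒≤ (≰⇒> m≰o))) le))

ramseyBound : ℕ → ℕ → ℕ
ramseyBound zero    q       = 0
ramseyBound (suc p) zero    = 0
ramseyBound (suc p) (suc q) = suc (ramseyBound p (suc q) + ramseyBound (suc p) q)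

module _ {A : Set} where

  AllPairs-resp-⊆ : ∀ {R : A → A → Set} {xs ys} → xs ⊆ ys → AllPairs R ys → AllPairs R xs
  AllPairs-resp-⊆ []         []       = []
  AllPairs-resp-⊆ (y ∷ʳ τ)   (_ ∷ rs) = AllPairs-resp-⊆ τ rs
  AllPairs-resp-⊆ (refl ∷ τ) (r ∷ rs) = All-resp-⊆ τ r ∷ AllPairs-resp-⊆ τ rs

  record LongSublist (n : ℕ) (Q : List A → Set) (xs : List A) : Set where
    constructor sublist
    field
      {elems} : List A
      ⊆xs     : elems ⊆ xs
      long    : n ≤ length elems
      holds   : Q elems

  widen : ∀ {n Q xs ys} → xs ⊆ ys → LongSublist n Q xs → LongSublist n Q ys
  widen τ (sublist σ l q) = sublist (⊆-trans σ τ) l q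

  module _ {P : A → Set} (P? : Decidable P) where

    length-filter+filter-∁ : ∀ xs → length xs ≡ length (filter P? xs) + length (filter (∁? P?) xs)
    length-filter+filter-∁ []       = refl
    length-filter+filter-∁ (x ∷ xs) with P? x
    ... | yes _ = cong suc (length-filter+filter-∁ xs)
    ... | no  _ = trans (cong suc (length-filter+filter-∁ xs))
                        (sym (+-suc (length (filter P? xs)) _))

    length-filter-drops-one : ∀ {R : A → A → Set} {xs} → AllPairs R xs →
      (∀ {x y} → ¬ P x → ¬ P y → ¬ R x y) → length xs ≤ suc (length (filter P? xs))
    length-filter-drops-one {xs = []}     _        _   = z≤n
    length-filter-drops-one {xs = x ∷ xs} (r ∷ rs) bad with P? x
    ... | yes _ = s≤s (length-filter-drops-one rs bad)
    ... | no ¬px = s≤s (≤-reflexive (sym (cong length (filter-all P? (All.map keep r)))))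
      where
      keep : ∀ {y} → _ → P y
      keep {y} rxy with P? y
      ... | yes py  = py
      ... | no ¬py = ⊥-elim (bad ¬px ¬py rxy)

  Homogeneous : (A → A → Set) → ℕ → ℕ → List A → Set
  Homogeneous R p q xs =
    LongSublist p (AllPairs R) xs ⊎ LongSublist q (AllPairs (λ x y → ¬ R x y)) xs

  ramsey : ∀ {R : A → A → Set} → (∀ x y → Dec (R x y)) →
           ∀ p q xs → ramseyBound p q ≤ length xs → Homogeneous R p q xs
  ramsey R? zero    q       xs _ = inj₁ (sublist (minimum xs) z≤n [])
  ramsey R? (suc p) zero    xs _ = inj₂ (sublist (minimum xs) z≤n [])
  ramsey R? (suc p) (suc q) (x ∷ xs) (s≤s big)
    with m+n≤o+p⇒m≤o⊎n≤p _ _ _ _ (≤-trans big (≤-reflexive (length-filter+filter-∁ (R? x) xs)))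
  ... | inj₁ big₁ with ramsey R? p (suc q) (filter (R? x) xs) big₁
  ...   | inj₁ (sublist τ l rs) =
          inj₁ (sublist (refl ∷ ⊆-trans τ (filter-⊆ (R? x) xs)) (s≤s l)
                        (All-resp-⊆ τ (all-filter (R? x) xs) ∷ rs))
  ...   | inj₂ h = inj₂ (widen (x ∷ʳ filter-⊆ (R? x) xs) h)
  ramsey R? (suc p) (suc q) (x ∷ xs) (s≤s big)
      | inj₂ big₂ with ramsey R? (suc p) q (filter (∁? (R? x)) xs) big₂
  ...   | inj₁ h = inj₁ (widen (x ∷ʳ filter-⊆ (∁? (R? x)) xs) h)
  ...   | inj₂ (sublist τ l rs) =
          inj₂ (sublist (refl ∷ ⊆-trans τ (filter-⊆ (∁? (R? x)) xs)) (s≤s l)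
                        (All-resp-⊆ τ (all-filter (∁? (R? x)) xs) ∷ rs))

  lookup-AllPairs : ∀ {R : A → A → Set} {xs} → AllPairs R xs →
                    ∀ {i j} → i Fin.< j → R (lookup xs i) (lookup xs j)
  lookup-AllPairs (r ∷ _)  {Fin.zero}  {Fin.suc j} _         = All.lookup r (∈-lookup j)
  lookup-AllPairs (_ ∷ rs) {Fin.suc i} {Fin.suc j} (s≤s i<j) = lookup-AllPairs rs i<j

  module Family {xs : List A} {n : ℕ} (n≤length : n ≤ length xs) where

    member : Fin n → A
    member i = lookup xs (inject≤ i n≤length)

    member-All : ∀ {P : A → Set} → All P xs → ∀ i → P (member i)
    member-All ps i = All.lookup ps (∈-lookup (inject≤ i n≤length))

    member-AllPairs : ∀ {R : A → A → Set} → AllPairs R xs → ∀ {i j} → i Fin.< j → R (member i) (member j)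
    member-AllPairs rs {i} {j} i<j = lookup-AllPairs rs
      (subst₂ _<_ (sym (Fin.toℕ-inject≤ i n≤length)) (sym (Fin.toℕ-inject≤ j n≤length)) i<j)

  AllPairs-last : ∀ {R : A → A → Set} x xs → AllPairs R (x ∷ xs) →
    ∃ λ z → ∃ λ ys → z ∈ x ∷ xs × ys ⊆ x ∷ xs × length ys ≡ length xs × All (λ y → R y z) ys
  AllPairs-last x []       _          = x , [] , here refl , minimum _ , refl , []
  AllPairs-last x (y ∷ xs) (rx ∷ rs) with AllPairs-last y xs rs
  ... | z , ys , z∈ , ys⊆ , same-length , ys-R-z =
    z , x ∷ ys , there z∈ , refl ∷ ys⊆ , cong suc same-length , All.lookup rx z∈ ∷ ys-R-z

  increasing-spread : ∀ (f : A → ℕ) x y ys → AllPairs (λ a b → f a < f b) (x ∷ y ∷ ys) →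
                      ∃ λ z → z ∈ y ∷ ys × f x + suc (length ys) ≤ f z
  increasing-spread f x y []       ((fx<fy ∷ []) ∷ _) =
    y , here refl , ≤-trans (≤-reflexive (+-comm (f x) 1)) fx<fy
  increasing-spread f x y (w ∷ ws) ((fx<fy ∷ _) ∷ rs) with increasing-spread f y w ws rs
  ... | z , z∈ , fy+≤fz =
    z , there z∈ , ≤-trans (≤-reflexive (+-suc (f x) _)) (≤-trans (+-monoˡ-≤ _ fx<fy) fy+≤fz)

≢⇒by-order : ∀ {n} {S : Fin n → Fin n → Set} → (∀ {i j} → i Fin.< j → S i j) →
             (∀ {i j} → S i j → S j i) → ∀ {i j} → i ≢ j → S i j
≢⇒by-order S< S-sym {i} {j} i≢j with Fin.<-cmp i j
... | tri< i<j _ _ = S< i<j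
... | tri≈ _ i≡j _ = ⊥-elim (i≢j i≡j)
... | tri> _ _ j<i = S-sym (S< j<i)

injective-by-order : ∀ {n} {A : Set} {f : Fin n → A} → (∀ {i j} → i Fin.< j → f i ≢ f j) →
                     ∀ i j → f i ≡ f j → i ≡ j
injective-by-order f< i j eq with Fin.<-cmp i j
... | tri< i<j _ _ = ⊥-elim (f< i<j eq)
... | tri≈ _ i≡j _ = i≡j
... | tri> _ _ j<i = ⊥-elim (f< j<i (sym eq))

spiderBound : ℕ → ℕ
spiderBound s = ramseyBound (suc s) (ramseyBound (suc s) (s + s))

backDegreeBound : ℕ → ℕ → ℕ → ℕ
backDegreeBound s t k = ramseyBound (suc (iterate (ramseyBound k) (spiderBound s) t)) (suc (suc t))

module GraphFacts (G : Graph) where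

  E-sym : ∀ {u v} → E G u v → E G v u
  E-sym {u} {v} = subst T (Graph.sym G u v)

  E-irrefl : ∀ {v} → ¬ E G v v
  E-irrefl {v} = subst T (irrefl G v)

  record Spider (s t : ℕ) : Set where
    field
      centre         : Fin (n G)
      leg            : Fin s → ℕ → Fin (n G)
      centre∉legs    : ∀ i p → p < t → centre ≢ leg i p
      leg-injective  : ∀ i j p q → p < t → q < t → leg i p ≡ leg j q → i ≡ j × p ≡ q
      centre-adj     : ∀ i → E G centre (leg i 0)
      centre-nonadj  : ∀ i p → p < t → 0 < p → ¬ E G centre (leg i p)
      leg-adj        : ∀ i p → suc p < t → E G (leg i p) (leg i (suc p))
      leg-nonadj     : ∀ i p q → q < t → suc p < q → ¬ E G (leg i p) (leg i q)
      legs-nonadj    : ∀ i j p q → p < t → q < t → i ≢ j → ¬ E G (leg i p) (leg j q)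

  Spider⇒ContainsInducedS : ∀ {s t} → Spider s t → ContainsInducedS s t G
  Spider⇒ContainsInducedS {s} {t} S = f , f-injective , f-adj , f-reflects-adj
    where
    open Spider S

    f : SVert s t → Fin (n G)
    f nothing        = centre
    f (just (i , p)) = leg i (toℕ p)

    f-injective : ∀ x y → f x ≡ f y → x ≡ y
    f-injective nothing        nothing        _  = refl
    f-injective nothing        (just (i , p)) eq = ⊥-elim (centre∉legs i (toℕ p) (Fin.toℕ<n p) eq)
    f-injective (just (i , p)) nothing        eq = ⊥-elim (centre∉legs i (toℕ p) (Fin.toℕ<n p) (sym eq))
    f-injective (just (i , p)) (just (j , q)) eq
      with leg-injective i j (toℕ p) (toℕ q) (Fin.toℕ<n p) (Fin.toℕ<n q) eq
    ... | refl , p≡q = cong (λ r → just (i , r)) (Fin.toℕ-injective p≡q)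

    f-adj : ∀ x y → SAdj x y → E G (f x) (f y)
    f-adj nothing        (just (i , p)) p≡0 rewrite p≡0 = centre-adj i
    f-adj (just (i , p)) nothing        p≡0 rewrite p≡0 = E-sym (centre-adj i)
    f-adj (just (i , p)) (just (.i , q)) (refl , inj₁ q≡1+p) rewrite q≡1+p =
      leg-adj i (toℕ p) (subst (_< t) q≡1+p (Fin.toℕ<n q))
    f-adj (just (i , p)) (just (.i , q)) (refl , inj₂ p≡1+q) rewrite p≡1+q =
      E-sym (leg-adj i (toℕ q) (subst (_< t) p≡1+q (Fin.toℕ<n p)))

    f-reflects-adj : ∀ x y → E G (f x) (f y) → SAdj x y
    f-reflects-adj nothing nothing e = E-irrefl e
    f-reflects-adj nothing (just (i , p)) e with toℕ p | Fin.toℕ<n p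
    ... | zero  | _   = refl
    ... | suc _ | p<t = ⊥-elim (centre-nonadj i _ p<t (s≤s z≤n) e)
    f-reflects-adj (just (i , p)) nothing e with toℕ p | Fin.toℕ<n p
    ... | zero  | _   = refl
    ... | suc _ | p<t = ⊥-elim (centre-nonadj i _ p<t (s≤s z≤n) (E-sym e))
    f-reflects-adj (just (i , p)) (just (j , q)) e with i Fin.≟ j
    ... | no i≢j = ⊥-elim (legs-nonadj i j (toℕ p) (toℕ q) (Fin.toℕ<n p) (Fin.toℕ<n q) i≢j e)
    ... | yes refl with <-cmp (toℕ p) (toℕ q)
    ...   | tri≈ _ p≡q _ rewrite Fin.toℕ-injective p≡q = ⊥-elim (E-irrefl e)
    ...   | tri< p<q _ _ with m≤n⇒m<n∨m≡n p<q
    ...     | inj₂ q≡1+p = refl , inj₁ (sym q≡1+p)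
    ...     | inj₁ 1+p<q = ⊥-elim (leg-nonadj i (toℕ p) (toℕ q) (Fin.toℕ<n q) 1+p<q e)
    f-reflects-adj (just (i , p)) (just (j , q)) e | yes refl | tri> _ _ q<p with m≤n⇒m<n∨m≡n q<p
    ...     | inj₂ p≡1+q = refl , inj₂ (sym p≡1+q)
    ...     | inj₁ 1+q<p = ⊥-elim (leg-nonadj i (toℕ q) (toℕ p) (Fin.toℕ<n p) 1+q<p (E-sym e))

module Ancestry {G : Graph} (Y : Gyarfas G) (B : Fin (m Y)) where

  Anc-trans : ∀ {A C D} → Anc (par Y) A C → Anc (par Y) C D → Anc (par Y) A D
  Anc-trans a anc-refl       = a
  Anc-trans a (anc-step p c) = anc-step p (Anc-trans a c)

  -- A root is its own parent here; HasAncestor r records that the first r steps are genuine.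
  ancestor : ℕ → Fin (m Y)
  ancestor zero    = B
  ancestor (suc r) = parentOr (par Y (ancestor r))
    where
    parentOr : Maybe (Fin (m Y)) → Fin (m Y)
    parentOr (just C) = C
    parentOr nothing  = ancestor r

  HasAncestor : ℕ → Set
  HasAncestor zero    = ⊤
  HasAncestor (suc r) = HasAncestor r × par Y (ancestor r) ≡ just (ancestor (suc r))

  hasAncestor? : ∀ r → Dec (HasAncestor r)
  hasAncestor? zero    = yes tt
  hasAncestor? (suc r) = hasAncestor? r ×-dec Maybe.≡-dec Fin._≟_ (par Y (ancestor r)) _

  parent-ancestor : ∀ {r} → HasAncestor (suc r) → par Y (ancestor r) ≡ just (ancestor (suc r))
  parent-ancestor = proj₂

  HasAncestor-≤ : ∀ {r r'} → r' ≤ r → HasAncestor r → HasAncestor r'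
  HasAncestor-≤ {r' = zero} _ _ = tt
  HasAncestor-≤ {suc r} {suc r'} r'≤r h with m≤n⇒m<n∨m≡n r'≤r
  ... | inj₁ (s≤s r'<r) = HasAncestor-≤ r'<r (proj₁ h)
  ... | inj₂ refl       = h

  depth-ancestor-< : ∀ {a b} → a < b → HasAncestor b → depth Y (ancestor b) < depth Y (ancestor a)
  depth-ancestor-< {a} {suc b} (s≤s a≤b) (h , p) with m≤n⇒m<n∨m≡n a≤b
  ... | inj₁ a<b  = <-trans (depth-par Y _ _ p) (depth-ancestor-< a<b h)
  ... | inj₂ refl = depth-par Y _ _ p

  ancestor-injective : ∀ {a b} → HasAncestor a → HasAncestor b → ancestor a ≡ ancestor b → a ≡ b
  ancestor-injective {a} {b} ha hb eq with <-cmp a b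
  ... | tri≈ _ a≡b _ = a≡b
  ... | tri< a<b _ _ = ⊥-elim (<-irrefl (cong (depth Y) (sym eq)) (depth-ancestor-< a<b hb))
  ... | tri> _ _ b<a = ⊥-elim (<-irrefl (cong (depth Y) eq) (depth-ancestor-< b<a ha))

  HasAncestor⇒≤depth : ∀ {r} → HasAncestor r → r ≤ depth Y B
  HasAncestor⇒≤depth {r} h = ≤-trans (m≤m+n r _) (climb h)
    where
    climb : ∀ {r} → HasAncestor r → r + depth Y (ancestor r) ≤ depth Y B
    climb {zero}  _       = ≤-refl
    climb {suc r} (h , p) =
      ≤-trans (≤-reflexive (sym (+-suc r _))) (≤-trans (+-monoʳ-≤ r (depth-par Y _ _ p)) (climb h))

  Anc-ancestor : ∀ {a b} → a ≤ b → HasAncestor b → Anc (par Y) (ancestor b) (ancestor a)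
  Anc-ancestor {b = zero} z≤n _ = anc-refl
  Anc-ancestor {a} {suc b} a≤1+b h with m≤n⇒m<n∨m≡n a≤1+b
  ... | inj₁ (s≤s a≤b) = Anc-trans (anc-step (parent-ancestor h) anc-refl) (Anc-ancestor a≤b (proj₁ h))
  ... | inj₂ refl      = anc-refl

  Anc⇒ancestor : ∀ {A C r} → Anc (par Y) A C → C ≡ ancestor r → HasAncestor r →
                 ∃ λ r' → A ≡ ancestor r' × HasAncestor r'
  Anc⇒ancestor {r = r} anc-refl         refl h = r , refl , h
  Anc⇒ancestor {r = r} (anc-step {c = C} p a) refl h =
    Anc⇒ancestor a (sym C≡parent) (h , trans p (cong just (sym C≡parent)))
    where
    C≡parent : ancestor (suc r) ≡ C
    C≡parent rewrite p = refl

  IsHookAbove : ℕ → Fin (n G) → Set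
  IsHookAbove r h =
    bag Y h ≡ ancestor (suc r) ×
    (∀ w → bag Y w ≡ ancestor r → E G h w) ×
    (∀ w → Anc (par Y) (ancestor r) (bag Y w) → bag Y w ≢ ancestor r → ¬ E G h w)

  private
    hookFor : ∀ r (P : Maybe (Fin (m Y))) → par Y (ancestor r) ≡ P → Fin (n G)
    hookFor r (just C) p = proj₁ (hook Y (ancestor r) C p)
    hookFor r nothing  _ = proj₁ (nonempty Y B)

    hookFor-spec : ∀ r P (p : par Y (ancestor r) ≡ P) → P ≡ just (ancestor (suc r)) →
                   IsHookAbove r (hookFor r P p)
    hookFor-spec r (just C) p refl = proj₂ (hook Y (ancestor r) C p)

  -- The default for a root is junk; hookAbove-spec only speaks about genuine parents.
  hookAbove : ℕ → Fin (n G)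
  hookAbove r = hookFor r (par Y (ancestor r)) refl

  hookAbove-spec : ∀ {r} → HasAncestor (suc r) → IsHookAbove r (hookAbove r)
  hookAbove-spec {r} h = hookFor-spec r _ refl (parent-ancestor h)

  hookAbove-bag : ∀ {r} → HasAncestor (suc r) → bag Y (hookAbove r) ≡ ancestor (suc r)
  hookAbove-bag h = proj₁ (hookAbove-spec h)

  hookAbove-adj : ∀ {r w} → HasAncestor (suc r) → bag Y w ≡ ancestor r → E G (hookAbove r) w
  hookAbove-adj {w = w} h = proj₁ (proj₂ (hookAbove-spec h)) w

  hookAbove-nonadj : ∀ {r w p} → HasAncestor (suc r) → bag Y w ≡ ancestor p → p < r →
                     ¬ E G (hookAbove r) w
  hookAbove-nonadj {r} {w} {p} h w∈p p<r =
    proj₂ (proj₂ (hookAbove-spec h)) w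
      (subst (Anc (par Y) (ancestor r)) (sym w∈p) (Anc-ancestor (<⇒≤ p<r) (proj₁ h)))
      (λ eq → <⇒≢ p<r (ancestor-injective (HasAncestor-≤ (<⇒≤ p<r) (proj₁ h)) (proj₁ h)
                                          (trans (sym w∈p) eq)))

  different-levels⇒≢ : ∀ {a b w w'} → HasAncestor a → HasAncestor b → a ≢ b →
                       bag Y w ≡ ancestor a → bag Y w' ≡ ancestor b → w ≢ w'
  different-levels⇒≢ ha hb a≢b w∈a w'∈b refl = a≢b (ancestor-injective ha hb (trans (sym w∈a) w'∈b))

module BackEdges {G : Graph} (Y : Gyarfas G) (B : Fin (m Y)) where
  open Ancestry Y B

  record BackEdge : Set where
    field
      level    : ℕ
      level≥1  : 1 ≤ level
      reached  : HasAncestor level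
      low      : Fin (n G)
      high     : Fin (n G)
      low∈B    : bag Y low ≡ ancestor 0
      high∈    : bag Y high ≡ ancestor level
      low~high : E G low high

  open BackEdge public

  BackEdgeAt : ℕ → Set
  BackEdgeAt r = 1 ≤ r × HasAncestor r × BagEdge Y B (ancestor r)

  backEdgeAt? : ∀ r → Dec (BackEdgeAt r)
  backEdgeAt? r = (1 ≤? r) ×-dec (hasAncestor? r ×-dec bagEdge? (ancestor r))
    where
    bagEdge? : ∀ A → Dec (BagEdge Y B A)
    bagEdge? A = Fin.any? λ u → Fin.any? λ w →
                   (bag Y u Fin.≟ B) ×-dec ((bag Y w Fin.≟ A) ×-dec T? (adj G u w))

  toBackEdge : ∀ {r} → BackEdgeAt r → BackEdge
  toBackEdge {r} (r≥1 , h , u , w , u∈B , w∈r , e) = record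
    { level = r ; level≥1 = r≥1 ; reached = h ; low = u ; high = w
    ; low∈B = u∈B ; high∈ = w∈r ; low~high = e }

  backEdgesFrom : ℕ → ℕ → List BackEdge
  backEdgesFrom a zero    = []
  backEdgesFrom a (suc N) with backEdgeAt? a
  ... | yes e = toBackEdge e ∷ backEdgesFrom (suc a) N
  ... | no  _ = backEdgesFrom (suc a) N

  backEdgesFrom-≥ : ∀ a N → All (λ x → a ≤ level x) (backEdgesFrom a N)
  backEdgesFrom-≥ a zero    = []
  backEdgesFrom-≥ a (suc N) with backEdgeAt? a
  ... | yes _ = ≤-refl ∷ All.map <⇒≤ (backEdgesFrom-≥ (suc a) N)
  ... | no  _ = All.map <⇒≤ (backEdgesFrom-≥ (suc a) N)

  backEdgesFrom-sorted : ∀ a N → AllPairs (λ x y → level x < level y) (backEdgesFrom a N)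
  backEdgesFrom-sorted a zero    = []
  backEdgesFrom-sorted a (suc N) with backEdgeAt? a
  ... | yes _ = backEdgesFrom-≥ (suc a) N ∷ backEdgesFrom-sorted (suc a) N
  ... | no  _ = backEdgesFrom-sorted (suc a) N

  backEdgesFrom-complete : ∀ a N r → BackEdgeAt r → a ≤ r → r < a + N →
                           ancestor r ∈ map (ancestor ∘ level) (backEdgesFrom a N)
  backEdgesFrom-complete a zero r _ a≤r r<a+0 =
    ⊥-elim (<⇒≱ r<a+0 (≤-trans (≤-reflexive (+-identityʳ a)) a≤r))
  backEdgesFrom-complete a (suc N) r e a≤r r<a+N with backEdgeAt? a | m≤n⇒m<n∨m≡n a≤r
  ... | yes _  | inj₂ refl = here refl
  ... | no ¬ea | inj₂ refl = ⊥-elim (¬ea e)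
  ... | yes _  | inj₁ a<r  = there (backEdgesFrom-complete (suc a) N r e a<r (≤-trans r<a+N (≤-reflexive (+-suc a N))))
  ... | no  _  | inj₁ a<r  = backEdgesFrom-complete (suc a) N r e a<r (≤-trans r<a+N (≤-reflexive (+-suc a N)))

  BackDegreeAtMost-≤ : ∀ {a b} → a ≤ b → BackDegreeAtMost Y B a → BackDegreeAtMost Y B b
  BackDegreeAtMost-≤ a≤b (L , L≤a , complete) = L , ≤-trans L≤a a≤b , complete

  backEdges : List BackEdge
  backEdges = backEdgesFrom 1 (depth Y B)

  backDegree≤length-backEdges : BackDegreeAtMost Y B (length backEdges)
  backDegree≤length-backEdges =
    map (ancestor ∘ level) backEdges , ≤-reflexive (length-map _ backEdges) , complete
    where
    complete : ∀ A → StrictAnc Y A B → BagEdge Y B A → A ∈ map (ancestor ∘ level) backEdges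
    complete A (A≤B , A≢B) e with Anc⇒ancestor A≤B refl tt
    ... | zero  , refl , _ = ⊥-elim (A≢B refl)
    ... | suc r , refl , h =
      backEdgesFrom-complete 1 (depth Y B) (suc r) (s≤s z≤n , h , e) (s≤s z≤n) (s≤s (HasAncestor⇒≤depth h))

module Legs {G : Graph} (bip : Bipartite G) (Y : Gyarfas G) (B : Fin (m Y)) (t : ℕ) where
  open Ancestry Y B
  open BackEdges Y B
  open GraphFacts G

  record HasRoom (x : BackEdge) : Set where
    constructor hasRoom
    field
      level≥2       : 2 ≤ level x
      room-above    : HasAncestor (level x + t)

  leg : BackEdge → ℕ → Fin (n G)
  leg x zero          = low x
  leg x (suc zero)    = high x
  leg x (suc (suc q)) = hookAbove (level x + q)

  legLevel : BackEdge → ℕ → ℕ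
  legLevel x zero    = 0
  legLevel x (suc p) = level x + p

  module _ {x : BackEdge} (room : HasRoom x) where

    HasRoom⇒HasAncestor : ∀ {a} → a ≤ t → HasAncestor (level x + a)
    HasRoom⇒HasAncestor a≤t = HasAncestor-≤ (+-monoʳ-≤ (level x) a≤t) (HasRoom.room-above room)

    hookAbove-HasAncestor : ∀ {q} → suc q ≤ t → HasAncestor (suc (level x + q))
    hookAbove-HasAncestor {q} 1+q≤t = subst HasAncestor (+-suc (level x) q) (HasRoom⇒HasAncestor 1+q≤t)

    legLevel-HasAncestor : ∀ {p} → p ≤ t → HasAncestor (legLevel x p)
    legLevel-HasAncestor {zero}  _   = tt
    legLevel-HasAncestor {suc p} p≤t = HasRoom⇒HasAncestor (≤-trans (n≤1+n p) p≤t)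

    leg-bag : ∀ {p} → p ≤ t → bag Y (leg x p) ≡ ancestor (legLevel x p)
    leg-bag {zero}        _   = low∈B x
    leg-bag {suc zero}    _   = trans (high∈ x) (cong ancestor (sym (+-identityʳ (level x))))
    leg-bag {suc (suc q)} p≤t = trans (hookAbove-bag (hookAbove-HasAncestor (≤-trans (n≤1+n _) p≤t)))
                                      (cong ancestor (sym (+-suc (level x) q)))

    legLevel-<-level+1+t : ∀ {p} → p ≤ t → legLevel x p < level x + suc t
    legLevel-<-level+1+t {zero}  _   =
      ≤-trans (s≤s z≤n) (≤-trans (HasRoom.level≥2 room) (m≤m+n (level x) (suc t)))
    legLevel-<-level+1+t {suc p} p≤t = +-monoʳ-< (level x) (s≤s (≤-trans (n≤1+n p) p≤t))

    legLevel-suc-≥2 : ∀ q → 2 ≤ legLevel x (suc q)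
    legLevel-suc-≥2 q = ≤-trans (HasRoom.level≥2 room) (m≤m+n (level x) q)

    legLevel-injective : ∀ {p q} → legLevel x p ≡ legLevel x q → p ≡ q
    legLevel-injective {zero}  {zero}  _  = refl
    legLevel-injective {zero}  {suc q} eq = ⊥-elim (<⇒≢ (≤-trans (s≤s z≤n) (legLevel-suc-≥2 q)) eq)
    legLevel-injective {suc p} {zero}  eq = ⊥-elim (<⇒≢ (≤-trans (s≤s z≤n) (legLevel-suc-≥2 p)) (sym eq))
    legLevel-injective {suc p} {suc q} eq = cong suc (+-cancelˡ-≡ (level x) p q eq)

    legLevel-<-hookLevel : ∀ {p q} → p ≤ q → legLevel x p < level x + q
    legLevel-<-hookLevel {zero}  {q} _       = ≤-trans (s≤s z≤n) (legLevel-suc-≥2 q)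
    legLevel-<-hookLevel {suc p} {q} 1+p≤q   = +-monoʳ-< (level x) 1+p≤q

    leg-adj : ∀ {p} → suc p ≤ t → E G (leg x p) (leg x (suc p))
    leg-adj {zero}  _     = low~high x
    leg-adj {suc p} 2+p≤t = E-sym (hookAbove-adj (hookAbove-HasAncestor (≤-trans (n≤1+n _) 2+p≤t))
                                                 (leg-bag (≤-trans (n≤1+n _) 2+p≤t)))

    leg-nonadj : ∀ {p q} → q ≤ t → suc p < q → ¬ E G (leg x p) (leg x q)
    leg-nonadj {p} {suc (suc q)} q≤t (s≤s (s≤s p≤q)) e =
      hookAbove-nonadj (hookAbove-HasAncestor (≤-trans (n≤1+n _) q≤t))
                       (leg-bag (≤-trans p≤q (≤-trans (n≤1+n _) (≤-trans (n≤1+n _) q≤t))))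
                       (legLevel-<-hookLevel p≤q) (E-sym e)

    leg-injective : ∀ {p q} → p ≤ t → q ≤ t → leg x p ≡ leg x q → p ≡ q
    leg-injective p≤t q≤t eq =
      legLevel-injective (ancestor-injective (legLevel-HasAncestor p≤t) (legLevel-HasAncestor q≤t)
        (trans (sym (leg-bag p≤t)) (trans (cong (bag Y) eq) (leg-bag q≤t))))

    hook₀-adj-low : E G (hookAbove 0) (low x)
    hook₀-adj-low =
      hookAbove-adj (HasAncestor-≤ (≤-trans (s≤s z≤n) (legLevel-suc-≥2 0)) (HasRoom⇒HasAncestor z≤n))
                    (low∈B x)

  Spaced : BackEdge → BackEdge → Set
  Spaced x y = level x + suc t ≤ level y

  Unhooked : ℕ → BackEdge → BackEdge → Set
  Unhooked j x y = ∀ o → o < j → ¬ E G (high y) (hookAbove (level x + o))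

  LowToHigh : BackEdge → BackEdge → Set
  LowToHigh x y = E G (low x) (high y)

  private
    colour : Fin (n G) → Bool
    colour = proj₁ bip

    E⇒colour-flips : ∀ {u v} → E G u v → colour u ≡ not (colour v)
    E⇒colour-flips e = ¬-not (proj₂ bip _ _ e)

    same-colour⇒¬E : ∀ {u v} → colour u ≡ colour v → ¬ E G u v
    same-colour⇒¬E same e = proj₂ bip _ _ e same

    low-colour : ∀ {x} → HasRoom x → colour (low x) ≡ not (colour (hookAbove 0))
    low-colour rx = E⇒colour-flips (E-sym (hook₀-adj-low rx))

    high-colour : ∀ {x} → HasRoom x → colour (high x) ≡ colour (hookAbove 0)
    high-colour {x} rx =
      trans (E⇒colour-flips (E-sym (low~high x))) (trans (cong not (low-colour rx)) (not-involutive _))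

  lows-nonadj : ∀ {x y} → HasRoom x → HasRoom y → ¬ E G (low x) (low y)
  lows-nonadj rx ry = same-colour⇒¬E (trans (low-colour rx) (sym (low-colour ry)))

  highs-nonadj : ∀ {x y} → HasRoom x → HasRoom y → ¬ E G (high x) (high y)
  highs-nonadj rx ry = same-colour⇒¬E (trans (high-colour rx) (sym (high-colour ry)))

  module _ {x y : BackEdge} (rx : HasRoom x) (ry : HasRoom y) (spaced : Spaced x y) where

    legLevel-<-level : ∀ {p} → p ≤ t → legLevel x p < level y
    legLevel-<-level p≤t = ≤-trans (legLevel-<-level+1+t rx p≤t) spaced

    legLevel-≢ : ∀ {p q} → p ≤ t → (p ≡ 0 → q ≡ 0 → ⊥) → legLevel x p ≢ legLevel y q
    legLevel-≢ {zero}  {zero}  _   not00 _  = not00 refl refl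
    legLevel-≢ {zero}  {suc q} _   _     eq = <⇒≢ (≤-trans (s≤s z≤n) (legLevel-suc-≥2 ry q)) eq
    legLevel-≢ {suc p} {zero}  _   _     eq = <⇒≢ (≤-trans (s≤s z≤n) (legLevel-suc-≥2 rx p)) (sym eq)
    legLevel-≢ {suc p} {suc q} p≤t _     eq =
      <⇒≢ (≤-trans (legLevel-<-level p≤t) (m≤m+n (level y) q)) eq

    legs-disjoint : ∀ {p q} → p ≤ t → q ≤ t → (p ≡ 0 → q ≡ 0 → ¬ LowToHigh x y) →
                    leg x p ≢ leg y q
    legs-disjoint {zero} {zero} _ _ no-low-high eq =
      no-low-high refl refl (subst (λ w → E G w (high y)) (sym eq) (low~high y))
    legs-disjoint {suc p} {q} p≤t q≤t _ =
      different-levels⇒≢ (legLevel-HasAncestor rx p≤t) (legLevel-HasAncestor ry q≤t)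
        (legLevel-≢ {q = q} p≤t (λ ())) (leg-bag rx p≤t) (leg-bag ry q≤t)
    legs-disjoint {zero} {suc q} p≤t q≤t _ =
      different-levels⇒≢ tt (legLevel-HasAncestor ry q≤t)
        (legLevel-≢ p≤t (λ _ ())) (low∈B x) (leg-bag ry q≤t)

    legs-nonadj : ∀ {p q} → Unhooked t x y → p ≤ t → q ≤ t →
                  (p ≡ 0 → q ≡ 1 → ¬ LowToHigh x y) → (p ≡ 1 → q ≡ 0 → ¬ LowToHigh y x) →
                  ¬ E G (leg x p) (leg y q)
    legs-nonadj {p} {suc (suc q)} _ p≤t q≤t _ _ e =
      hookAbove-nonadj (hookAbove-HasAncestor ry (≤-trans (n≤1+n _) q≤t)) (leg-bag rx p≤t)
                       (≤-trans (legLevel-<-level p≤t) (m≤m+n (level y) q)) (E-sym e)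
    legs-nonadj {zero}        {zero}     _ _ _ _ _ e = lows-nonadj rx ry e
    legs-nonadj {suc zero}    {zero}     _ _ _ _ no-high-low e = no-high-low refl refl (E-sym e)
    legs-nonadj {suc (suc p)} {zero}     _ p≤t _ _ _ e =
      hookAbove-nonadj (hookAbove-HasAncestor rx (≤-trans (n≤1+n _) p≤t)) (low∈B y)
                       (≤-trans (s≤s z≤n) (legLevel-suc-≥2 rx p)) e
    legs-nonadj {zero}        {suc zero} _ _ _ no-low-high _ e = no-low-high refl refl e
    legs-nonadj {suc zero}    {suc zero} _ _ _ _ _ e = highs-nonadj rx ry e
    legs-nonadj {suc (suc p)} {suc zero} unhooked p≤t _ _ _ e = unhooked p (≤-trans (n≤1+n _) p≤t) (E-sym e)

  -- The legs start at the high ends (σ = 1) or at the low ends (σ = 0); the latter needs the centre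
  -- off level 0 and no edges between a lower and an high end.
  module StarOfLegs {s : ℕ} (σ : ℕ) (σ≤1 : σ ≤ 1)
    {z : Fin (n G)} {zLevel : ℕ} (zLevel≤1 : zLevel ≤ 1) (z-reached : HasAncestor zLevel)
    (z∈ : bag Y z ≡ ancestor zLevel)
    (e : Fin s → BackEdge) (room : ∀ i → HasRoom (e i))
    (ordered : ∀ {i j} → i Fin.< j → Spaced (e i) (e j) × Unhooked t (e i) (e j))
    (z-adj : ∀ i → E G z (leg (e i) σ))
    (fromLow : σ ≡ 0 → zLevel ≡ 1 ×
               (∀ {i j} → i Fin.< j → ¬ LowToHigh (e i) (e j) × ¬ LowToHigh (e j) (e i)) ×
               (∀ i → ¬ E G z (high (e i))))
    where

    private
      σ+p≤t : ∀ {p} → p < t → σ + p ≤ t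
      σ+p≤t {p} p<t = ≤-trans (+-monoˡ-≤ p σ≤1) p<t

      σ+p≡1⇒σ≡0 : ∀ {p} → 0 < p → σ + p ≡ 1 → σ ≡ 0
      σ+p≡1⇒σ≡0 {p} 0<p eq =
        n≤0⇒n≡0 (+-cancelʳ-≤ 1 σ 0 (≤-trans (+-monoʳ-≤ σ 0<p) (≤-reflexive eq)))

      zLevel-≢ : ∀ {x q} → HasRoom x → (q ≡ 0 → zLevel ≡ 1) → zLevel ≢ legLevel x q
      zLevel-≢ {q = zero}  _  q≡0⇒1 eq = 1+n≢0 (trans (sym (q≡0⇒1 refl)) eq)
      zLevel-≢ {q = suc q} rx _     eq =
        <⇒≢ (≤-trans (s≤s zLevel≤1) (legLevel-suc-≥2 rx q)) eq

      z-nonadj : ∀ {x q} → HasRoom x → q ≤ t → 1 ≤ q → (q ≡ 1 → ¬ E G z (high x)) →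
                 ¬ E G z (leg x q)
      z-nonadj {q = suc zero}    _  _   _ ¬z~high = ¬z~high refl
      z-nonadj {q = suc (suc q)} rx q≤t _ _ e =
        hookAbove-nonadj (hookAbove-HasAncestor rx (≤-trans (n≤1+n _) q≤t)) z∈
                         (≤-trans (s≤s zLevel≤1) (legLevel-suc-≥2 rx q)) (E-sym e)

      lowStart-apart : ∀ {i j p} → i Fin.< j → σ + p ≡ 0 → ¬ LowToHigh (e i) (e j) × ¬ LowToHigh (e j) (e i)
      lowStart-apart i<j σ+p≡0 = proj₁ (proj₂ (fromLow (m+n≡0⇒m≡0 σ σ+p≡0))) i<j

    spider : Spider s t
    spider = record
      { centre        = z
      ; leg           = λ i p → leg (e i) (σ + p)
      ; centre∉legs   = λ i p p<t → different-levels⇒≢ z-reached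
                          (legLevel-HasAncestor (room i) (σ+p≤t p<t))
                          (zLevel-≢ (room i) (λ σ+p≡0 → proj₁ (fromLow (m+n≡0⇒m≡0 σ σ+p≡0))))
                          z∈ (leg-bag (room i) (σ+p≤t p<t))
      ; leg-injective = leg-injective′
      ; centre-adj    = λ i → subst (λ p → E G z (leg (e i) p)) (sym (+-identityʳ σ)) (z-adj i)
      ; centre-nonadj = λ i p p<t 0<p → z-nonadj (room i) (σ+p≤t p<t) (≤-trans 0<p (m≤n+m p σ))
                          (λ σ+p≡1 → proj₂ (proj₂ (fromLow (σ+p≡1⇒σ≡0 0<p σ+p≡1))) i)
      ; leg-adj       = λ i p 1+p<t → subst (λ q → E G (leg (e i) (σ + p)) (leg (e i) q)) (sym (+-suc σ p))
                          (leg-adj (room i) (≤-trans (≤-reflexive (sym (+-suc σ p))) (σ+p≤t 1+p<t)))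
      ; leg-nonadj    = λ i p q q<t 1+p<q → leg-nonadj (room i) (σ+p≤t q<t)
                          (≤-trans (≤-reflexive (sym (trans (+-suc σ (suc p)) (cong suc (+-suc σ p)))))
                                   (+-monoʳ-≤ σ 1+p<q))
      ; legs-nonadj   = λ i j p q p<t q<t i≢j → ≢⇒by-order {S = LegsApart} apart< apart-sym i≢j p q p<t q<t
      }
      where
      leg-injective′ : ∀ i j p q → p < t → q < t → leg (e i) (σ + p) ≡ leg (e j) (σ + q) →
                       i ≡ j × p ≡ q
      leg-injective′ i j p q p<t q<t eq with Fin.<-cmp i j
      ... | tri≈ _ refl _ = refl , +-cancelˡ-≡ σ p q (leg-injective (room i) (σ+p≤t p<t) (σ+p≤t q<t) eq)
      ... | tri< i<j _ _ = ⊥-elim (legs-disjoint (room i) (room j) (proj₁ (ordered i<j))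
                             (σ+p≤t p<t) (σ+p≤t q<t)
                             (λ σ+p≡0 _ → proj₁ (lowStart-apart {p = p} i<j σ+p≡0)) eq)
      ... | tri> _ _ j<i = ⊥-elim (legs-disjoint (room j) (room i) (proj₁ (ordered j<i))
                             (σ+p≤t q<t) (σ+p≤t p<t)
                             (λ σ+q≡0 _ → proj₁ (lowStart-apart {p = q} j<i σ+q≡0)) (sym eq))

      LegsApart : Fin s → Fin s → Set
      LegsApart i j = ∀ p q → p < t → q < t → ¬ E G (leg (e i) (σ + p)) (leg (e j) (σ + q))

      apart< : ∀ {i j} → i Fin.< j → LegsApart i j
      apart< i<j p q p<t q<t =
        legs-nonadj (room _) (room _) (proj₁ (ordered i<j)) (proj₂ (ordered i<j)) (σ+p≤t p<t) (σ+p≤t q<t)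
          (λ σ+p≡0 _ → proj₁ (lowStart-apart {p = p} i<j σ+p≡0))
          (λ _ σ+q≡0 → proj₂ (lowStart-apart {p = q} i<j σ+q≡0))

      apart-sym : ∀ {i j} → LegsApart i j → LegsApart j i
      apart-sym apart p q p<t q<t e = apart q p q<t p<t (E-sym e)

  module ChainOfLegs {k o : ℕ} (o<t : o < t) (e : Fin k → BackEdge) (room : ∀ i → HasRoom (e i))
    (ordered : ∀ {i j} → i Fin.< j → Spaced (e i) (e j) × E G (high (e j)) (hookAbove (level (e i) + o)))
    where

    private
      level-< : ∀ {i j} → i Fin.< j → level (e i) < level (e j)
      level-< i<j = <-≤-trans (m<m+n (level (e _)) (s≤s z≤n)) (proj₁ (ordered i<j))

      hook-reached : ∀ i → HasAncestor (suc (level (e i) + o))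
      hook-reached i = hookAbove-HasAncestor (room i) o<t

      hook-level-≢ : ∀ i j → suc (level (e i) + o) ≢ level (e j)
      hook-level-≢ i j with Fin.<-cmp i j
      ... | tri< i<j _ _ = <⇒≢ (≤-trans (s≤s (+-monoʳ-< (level (e i)) o<t))
                                         (≤-trans (≤-reflexive (sym (+-suc _ t))) (proj₁ (ordered i<j))))
      ... | tri≈ _ refl _ = ≢-sym (<⇒≢ (s≤s (m≤m+n _ o)))
      ... | tri> _ _ j<i = ≢-sym (<⇒≢ (≤-trans (level-< j<i) (≤-trans (m≤m+n _ o) (n≤1+n _))))

    chain : HasChain G k
    chain = a , b , injective-by-order a-≢ , injective-by-order b-≢ , a≢b , λ i j i<j →
      E-sym (proj₂ (ordered i<j)) ,
      λ b~a → hookAbove-nonadj (hook-reached j) (high∈ (e i)) (≤-trans (level-< i<j) (m≤m+n _ o)) (E-sym b~a)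
      where
      a b : Fin k → Fin (n G)
      a i = hookAbove (level (e i) + o)
      b i = high (e i)

      a-≢ : ∀ {i j} → i Fin.< j → a i ≢ a j
      a-≢ {i} {j} i<j = different-levels⇒≢ (hook-reached i) (hook-reached j)
        (λ eq → <⇒≢ (+-monoˡ-< o (level-< i<j)) (suc-injective eq))
        (hookAbove-bag (hook-reached i)) (hookAbove-bag (hook-reached j))

      b-≢ : ∀ {i j} → i Fin.< j → b i ≢ b j
      b-≢ i<j = different-levels⇒≢ (reached (e _)) (reached (e _)) (<⇒≢ (level-< i<j))
                                   (high∈ (e _)) (high∈ (e _))

      a≢b : ∀ i j → a i ≢ b j
      a≢b i j = different-levels⇒≢ (hook-reached i) (reached (e j)) (hook-level-≢ i j)
        (hookAbove-bag (hook-reached i)) (high∈ (e j))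

  WellSpaced : ℕ → List BackEdge → Set
  WellSpaced j ys = All HasRoom ys × AllPairs (λ x y → Spaced x y × Unhooked j x y) ys

  WellSpaced-⊆ : ∀ {j xs ys} → xs ⊆ ys → WellSpaced j ys → WellSpaced j xs
  WellSpaced-⊆ τ (rooms , pairs) = All-resp-⊆ τ rooms , AllPairs-resp-⊆ τ pairs

  WellSpaced-suc : ∀ {j ys} → WellSpaced j ys →
    AllPairs (λ x y → ¬ E G (high y) (hookAbove (level x + j))) ys → WellSpaced (suc j) ys
  WellSpaced-suc {j} (rooms , pairs) unhooked =
    rooms , AllPairs.zipWith (λ {x} {y} → extend {x} {y}) (pairs , unhooked)
    where
    extend : ∀ {x y} → (Spaced x y × Unhooked j x y) × ¬ E G (high y) (hookAbove (level x + j)) →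
             Spaced x y × Unhooked (suc j) x y
    extend {x} {y} ((spaced , unhooked) , ¬hooked) = spaced , unhooked′
      where
      unhooked′ : Unhooked (suc j) x y
      unhooked′ o (s≤s o≤j) with m≤n⇒m<n∨m≡n o≤j
      ... | inj₁ o<j  = unhooked o o<j
      ... | inj₂ refl = ¬hooked

  unhook : ∀ {k} j N ys → j ≤ t → iterate (ramseyBound k) N j ≤ length ys → WellSpaced 0 ys →
           HasChain G k ⊎ LongSublist N (WellSpaced j) ys
  unhook zero N ys _ long ws = inj₂ (sublist ⊆-refl long ws)
  unhook {k} (suc j) N ys j<t long ws with unhook j (ramseyBound k N) ys (<⇒≤ j<t) long ws
  ... | inj₁ chain = inj₁ chain
  ... | inj₂ (sublist τ l wsj)
      with ramsey (λ x y → T? (adj G (high y) (hookAbove (level x + j)))) k N _ l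
  ...   | inj₁ (sublist {clique} σ l' hooked) =
          inj₁ (ChainOfLegs.chain j<t member (member-All (proj₁ ws′))
                  (λ {i j} → member-AllPairs (AllPairs.zip (AllPairs.map proj₁ (proj₂ ws′) , hooked)) {i} {j}))
    where
    open Family {xs = clique} l'
    ws′ : WellSpaced j clique
    ws′ = WellSpaced-⊆ σ wsj
  ...   | inj₂ (sublist σ l' unhooked) =
          inj₂ (sublist (⊆-trans σ τ) l' (WellSpaced-suc (WellSpaced-⊆ σ wsj) unhooked))

  increasing⇒Spaced : ∀ N xs → AllPairs (λ x y → level x < level y) xs →
    ramseyBound N (suc (suc t)) ≤ length xs → LongSublist N (AllPairs Spaced) xs
  increasing⇒Spaced N xs sorted long with ramsey (λ x y → level x + suc t ≤? level y) N (suc (suc t)) xs long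
  ... | inj₁ spaced = spaced
  ... | inj₂ (sublist {x ∷ y ∷ ys} τ (s≤s (s≤s t≤ys)) (notSpaced ∷ _))
      with increasing-spread level x y ys (AllPairs-resp-⊆ τ sorted)
  ...   | z , z∈ , gap = ⊥-elim (All.lookup notSpaced z∈ (≤-trans (+-monoʳ-≤ (level x) (s≤s t≤ys)) gap))

  module ChainOrSpider (s : ℕ) (reach₁ : HasAncestor 1) where

    spiderOnList : ∀ σ → σ ≤ 1 → ∀ {z zLevel} → zLevel ≤ 1 → HasAncestor zLevel →
      bag Y z ≡ ancestor zLevel →
      ∀ ys → s ≤ length ys → WellSpaced t ys → All (λ y → E G z (leg y σ)) ys →
      (σ ≡ 0 → zLevel ≡ 1 × AllPairs (λ x y → ¬ LowToHigh x y × ¬ LowToHigh y x) ys ×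
               All (λ y → ¬ E G z (high y)) ys) →
      ContainsInducedS s t G
    spiderOnList σ σ≤1 zLevel≤1 z-reached z∈ ys long (rooms , pairs) z-adj fromLow =
      Spider⇒ContainsInducedS (StarOfLegs.spider σ σ≤1 zLevel≤1 z-reached z∈ member (member-All rooms)
        (λ {i j} → member-AllPairs pairs {i} {j}) (member-All z-adj) fromLow′)
      where
      open Family {xs = ys} long
      fromLow′ : σ ≡ 0 → _
      fromLow′ σ≡0 with fromLow σ≡0
      ... | zLevel≡1 , apart , ¬z~high =
        zLevel≡1 , (λ {i j} → member-AllPairs apart {i} {j}) , member-All ¬z~high

    private
      hooked? : ∀ y → Dec (E G (hookAbove 0) (high y))
      hooked? y = T? (adj G (hookAbove 0) (high y))

      level≥2? : ∀ x → Dec (2 ≤ level x)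
      level≥2? x = 2 ≤? level x

      ¬level≥2⇒¬< : ∀ {x y} → ¬ 2 ≤ level x → ¬ 2 ≤ level y → ¬ level x < level y
      ¬level≥2⇒¬< {x} _ ¬2≤y x<y = ¬2≤y (≤-trans (s≤s (level≥1 x)) x<y)

      roomy? : ∀ x → Dec (HasAncestor (level x + t))
      roomy? x = hasAncestor? (level x + t)

      ¬roomy⇒¬Spaced : ∀ {x y} → ¬ HasAncestor (level x + t) → ¬ HasAncestor (level y + t) → ¬ Spaced x y
      ¬roomy⇒¬Spaced {y = y} ¬room _ spaced =
        ¬room (HasAncestor-≤ (≤-trans (+-monoʳ-≤ _ (n≤1+n t)) spaced) (reached y))

    lowHighFree⇒spider : ∀ ys → s + s ≤ length ys → WellSpaced t ys →
      AllPairs (λ x y → ¬ LowToHigh x y × ¬ LowToHigh y x) ys → ContainsInducedS s t G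
    lowHighFree⇒spider ys long ws apart
      with m+n≤o+p⇒m≤o⊎n≤p s s _ _ (≤-trans long (≤-reflexive (length-filter+filter-∁ hooked? ys)))
    ... | inj₁ manyHooked =
      spiderOnList 1 ≤-refl ≤-refl reach₁ (hookAbove-bag reach₁) _ manyHooked
        (WellSpaced-⊆ (filter-⊆ hooked? ys) ws) (all-filter hooked? ys) (λ ())
    ... | inj₂ manyUnhooked =
      spiderOnList 0 z≤n ≤-refl reach₁ (hookAbove-bag reach₁) _ manyUnhooked
        (WellSpaced-⊆ (filter-⊆ (∁? hooked?) ys) ws)
        (All.map hook₀-adj-low (All-resp-⊆ (filter-⊆ (∁? hooked?) ys) (proj₁ ws)))
        (λ _ → refl , AllPairs-resp-⊆ (filter-⊆ (∁? hooked?) ys) apart , all-filter (∁? hooked?) ys)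

    noLowToHigh⇒spider : ∀ ys → ramseyBound (suc s) (s + s) ≤ length ys → WellSpaced t ys →
      AllPairs (λ x y → ¬ LowToHigh x y) ys → ContainsInducedS s t G
    noLowToHigh⇒spider ys long ws noForward
      with ramsey (λ x y → T? (adj G (low y) (high x))) (suc s) (s + s) ys long
    ... | inj₂ (sublist τ l noBackward) =
      lowHighFree⇒spider _ l (WellSpaced-⊆ τ ws) (AllPairs.zip (AllPairs-resp-⊆ τ noForward , noBackward))
    ... | inj₁ (sublist {x ∷ xs} τ (s≤s l) backward) with AllPairs-last x xs backward
    ...   | z , legs , _ , legs⊆ , same-length , toZ =
      spiderOnList 1 ≤-refl z≤n tt (low∈B z) legs (≤-trans l (≤-reflexive (sym same-length)))
        (WellSpaced-⊆ (⊆-trans legs⊆ τ) ws) toZ (λ ())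

    spaced⇒spider : ∀ ys → spiderBound s ≤ length ys → WellSpaced t ys →
                    ContainsInducedS s t G
    spaced⇒spider ys long ws with ramsey (λ x y → T? (adj G (low x) (high y))) (suc s) _ ys long
    ... | inj₂ (sublist τ l noForward) = noLowToHigh⇒spider _ l (WellSpaced-⊆ τ ws) noForward
    ... | inj₁ (sublist {x ∷ xs} τ (s≤s l) (fromX ∷ _)) =
      spiderOnList 1 ≤-refl z≤n tt (low∈B x) xs l (WellSpaced-⊆ (⊆-trans (x ∷ʳ ⊆-refl) τ) ws)
        fromX (λ ())


    increasing⇒chain-or-spider : ∀ {k} xs → AllPairs (λ x y → level x < level y) xs →
      backDegreeBound s t k < length xs → HasChain G k ⊎ ContainsInducedS s t G
    increasing⇒chain-or-spider {k} xs sorted long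
      with increasing⇒Spaced _ (filter level≥2? xs) (AllPairs-resp-⊆ (filter-⊆ level≥2? xs) sorted)
             (≤-pred (≤-trans long
               (length-filter-drops-one level≥2? sorted (λ {x} {y} → ¬level≥2⇒¬< {x} {y}))))
    ... | sublist {spaced} τ l spacedPairs
        with unhook t (spiderBound s) (filter roomy? spaced) ≤-refl
               (≤-pred (≤-trans l
                 (length-filter-drops-one roomy? spacedPairs (λ {x} {y} → ¬roomy⇒¬Spaced {x} {y}))))
               (rooms , AllPairs.map (λ sp → sp , λ _ ()) (AllPairs-resp-⊆ (filter-⊆ roomy? spaced) spacedPairs))
      where
      rooms : All HasRoom (filter roomy? spaced)
      rooms = All.zipWith (λ (level≥2 , roomAbove) → hasRoom level≥2 roomAbove)
                (All-resp-⊆ (⊆-trans (filter-⊆ roomy? spaced) τ) (all-filter level≥2? xs) ,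
                 all-filter roomy? spaced)
    ...   | inj₁ chain = inj₁ chain
    ...   | inj₂ (sublist _ l′ ws) = inj₂ (spaced⇒spider _ l′ ws)

module _ (s t k : ℕ) {G : Graph} (bip : Bipartite G) (Y : Gyarfas G) (B : Fin (m Y))
         (¬chain : ¬ HasChain G k) (¬spider : ¬ ContainsInducedS s t G) where
  open Ancestry Y B
  open BackEdges Y B
  open Legs bip Y B t

  increasing-length≤bound : ∀ xs → AllPairs (λ x y → level x < level y) xs →
                            length xs ≤ backDegreeBound s t k
  increasing-length≤bound []       _      = z≤n
  increasing-length≤bound (x ∷ xs) sorted with length (x ∷ xs) ≤? backDegreeBound s t k
  ... | yes short = short
  ... | no long
      with ChainOrSpider.increasing⇒chain-or-spider s (HasAncestor-≤ (level≥1 x) (reached x))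
             (x ∷ xs) sorted (≰⇒> long)
  ...   | inj₁ chain  = ⊥-elim (¬chain chain)
  ...   | inj₂ spider = ⊥-elim (¬spider spider)

  backDegree-bounded : BackDegreeAtMost Y B (backDegreeBound s t k)
  backDegree-bounded =
    BackDegreeAtMost-≤ (increasing-length≤bound backEdges (backEdgesFrom-sorted 1 (depth Y B)))
                       backDegree≤length-backEdges

lemma3p6 : ∀ (s t k : ℕ) → ∃ λ (ℓ : ℕ) →
    ∀ (G : Graph) → Bipartite G → ChainIndexBelow G k → ¬ ContainsInducedS s t G →
      ∀ (Y : Gyarfas G) → MaxBackDegreeAtMost Y ℓ
lemma3p6 s t k = backDegreeBound s t k , λ G bip ¬chain ¬spider Y B →
  backDegree-bounded s t k bip Y B ¬chain ¬spider
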